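{- Let $(A,\le,0,1)$ be a bounded MLUB-complete poset, $(T,R)$ a time frame with $R$ reflexive, and $P,F,H,G$ the tense operators induced by $(T,R)$. Then for every $q\in A^T$: $q\le\varphi(P(q))$, $q\le\varphi(F(q))$, $\varphi(H(q))\le q$, and $\varphi(G(q))\le q$.
   Context: For a poset and $X\subseteq A$: $L(X)$, $U(X)$ the sets of lower/upper bounds, $\operatorname{Max}X,\operatorname{Min}X$ the maximal/minimal elements. MLUB-complete: for every nonempty $M$, every upper bound of $M$ lies above a minimal upper bound and every lower bound below a maximal lower bound. $\mathcal P_+(X)$ = nonempty subsets. $A^T$ is ordered componentwise; for subsets $X,Y$ (singletons identified with their elements), $X\le Y$ iff $x\le y$ for all $x\in X,y\in Y$. A time frame is $(T,R)$, $T\ne\emptyset$, $R\subseteq T^2$. The induced tense operators $P,F,H,G:\mathcal P_+(A^T)\to(\mathcal P_+A)^T$ are $P(B)(s)=\operatorname{Min}U(\{p(t)\mid p\in B,tRs\})$, $F(B)(s)=\operatorname{Min}U(\{p(t)\mid p\in B,sRt\})$, $H(B)(s)=\operatorname{Max}L(\{p(t)\mid p\in B,tRs\})$, $G(B)(s)=\operatorname{Max}L(\{p(t)\mid p\in B,sRt\})$; $P(q)$ means $P(\{q\})$ etc. The transformation function $\varphi:(\mathcal P_+A)^T\to\mathcal P_+(A^T)$ is $\varphi(Z)=\{p\in A^T\mid p(t)\in Z(t)\text{ for all }t\in T\}$. -}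

module Defs where

open import Level using (Level; _⊔_)
open import Data.Product using (Σ; ∃; _×_; _,_)
open import Relation.Unary using (Pred)
open import Relation.Binary using (Rel; Reflexive)
open import Relation.Binary.Bundles using (Poset)
open import Relation.Binary.PropositionalEquality using (_≡_)

module PosetDefs {ℓ : Level} (𝔸 : Poset ℓ ℓ ℓ) where
  open Poset 𝔸 renaming (Carrier to A)

  Subset : Set (Level.suc ℓ)
  Subset = Pred A ℓ

  NonEmpty : Subset → Set ℓ
  NonEmpty X = ∃ λ x → X x

  L : Subset → Subset
  L X a = ∀ x → X x → a ≤ x

  U : Subset → Subset
  U X a = ∀ x → X x → x ≤ a

  Max : Subset → Subset
  Max X a = X a × (∀ y → X y → a ≤ y → a ≈ y)

  Min : Subset → Subset
  Min X a = X a × (∀ y → X y → y ≤ a → y ≈ a)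

  IsBounded : A → A → Set ℓ
  IsBounded bot top = (∀ x → bot ≤ x) × (∀ x → x ≤ top)

  MLUB-complete : Set (Level.suc ℓ)
  MLUB-complete =
    (∀ (M : Subset) → NonEmpty M →
       ∀ b → U M b → ∃ λ m → Min (U M) m × m ≤ b)
    × (∀ (M : Subset) → NonEmpty M →
       ∀ b → L M b → ∃ λ m → Max (L M) m × b ≤ m)

  module TenseDefs (T : Set ℓ) (R : Rel T ℓ) where

    SubsetT : Set (Level.suc ℓ)
    SubsetT = Pred (T → A) ℓ

    ⟦_⟧ : (T → A) → SubsetT
    ⟦ q ⟧ p = p ≡ q

    past-vals : SubsetT → T → Subset
    past-vals B s a = Σ (T → A) λ p → Σ T λ t → B p × R t s × p t ≈ a

    future-vals : SubsetT → T → Subset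
    future-vals B s a = Σ (T → A) λ p → Σ T λ t → B p × R s t × p t ≈ a

    P F H G : SubsetT → T → Subset
    P B s = Min (U (past-vals B s))
    F B s = Min (U (future-vals B s))
    H B s = Max (L (past-vals B s))
    G B s = Max (L (future-vals B s))

    φ : (T → Subset) → SubsetT
    φ Z p = ∀ t → Z t (p t)

    _≤ˢ_ : (T → A) → SubsetT → Set ℓ
    q ≤ˢ Y = ∀ p → Y p → ∀ t → q t ≤ p t

    _≥ˢ_ : (T → A) → SubsetT → Set ℓ
    q ≥ˢ Y = ∀ p → Y p → ∀ t → p t ≤ q t

{-# OPTIONS --safe #-}
module Submission where

-- By reflexivity of R, q s is itself one of the values {p t | p ∈ ⟦ q ⟧, t R s}
-- (and likewise for s R t), so every upper bound of them, in particular every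
-- element of P ⟦ q ⟧ s or F ⟦ q ⟧ s, lies above q s; dually for H and G.

open import Defs
open import Level using (Level)
open import Data.Product using (_×_; _,_)
open import Relation.Binary using (Rel; Reflexive)
open import Relation.Binary.Bundles using (Poset)
open import Relation.Binary.PropositionalEquality as ≡ using ()

module _ {ℓ : Level} (𝔸 : Poset ℓ ℓ ℓ) where
  open Poset 𝔸 renaming (Carrier to A)
  open PosetDefs 𝔸

  Min-U⇒upper : ∀ {X a x} → Min (U X) a → X x → x ≤ a
  Min-U⇒upper (a-upper , _) x∈X = a-upper _ x∈X

  Max-L⇒lower : ∀ {X a x} → Max (L X) a → X x → a ≤ x
  Max-L⇒lower (a-lower , _) x∈X = a-lower _ x∈X

  module _ (T : Set ℓ) (R : Rel T ℓ) (R-refl : Reflexive R) where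
    open TenseDefs T R

    ∈⇒self∈past-vals : ∀ {B q} → B q → ∀ s → past-vals B s (q s)
    ∈⇒self∈past-vals {q = q} q∈B s = q , s , q∈B , R-refl , Eq.refl

    ∈⇒self∈future-vals : ∀ {B q} → B q → ∀ s → future-vals B s (q s)
    ∈⇒self∈future-vals {q = q} q∈B s = q , s , q∈B , R-refl , Eq.refl

    ∈⇒≤ˢφP : ∀ {B q} → B q → q ≤ˢ φ (P B)
    ∈⇒≤ˢφP q∈B p p∈φPB t = Min-U⇒upper (p∈φPB t) (∈⇒self∈past-vals q∈B t)

    ∈⇒≤ˢφF : ∀ {B q} → B q → q ≤ˢ φ (F B)
    ∈⇒≤ˢφF q∈B p p∈φFB t = Min-U⇒upper (p∈φFB t) (∈⇒self∈future-vals q∈B t)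

    ∈⇒≥ˢφH : ∀ {B q} → B q → q ≥ˢ φ (H B)
    ∈⇒≥ˢφH q∈B p p∈φHB t = Max-L⇒lower (p∈φHB t) (∈⇒self∈past-vals q∈B t)

    ∈⇒≥ˢφG : ∀ {B q} → B q → q ≥ˢ φ (G B)
    ∈⇒≥ˢφG q∈B p p∈φGB t = Max-L⇒lower (p∈φGB t) (∈⇒self∈future-vals q∈B t)

theorem3p9 : {ℓ : Level} (𝔸 : Poset ℓ ℓ ℓ) → let open PosetDefs 𝔸 in
    (bot top : Poset.Carrier 𝔸) → IsBounded bot top → MLUB-complete →
    (T : Set ℓ) (R : Rel T ℓ) → Reflexive R → let open TenseDefs T R in
    (q : T → Poset.Carrier 𝔸) →
    (q ≤ˢ φ (P ⟦ q ⟧)) × (q ≤ˢ φ (F ⟦ q ⟧)) × (q ≥ˢ φ (H ⟦ q ⟧)) × (q ≥ˢ φ (G ⟦ q ⟧))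
theorem3p9 𝔸 _ _ _ _ T R R-refl q =
    ∈⇒≤ˢφP 𝔸 T R R-refl ≡.refl
  , ∈⇒≤ˢφF 𝔸 T R R-refl ≡.refl
  , ∈⇒≥ˢφH 𝔸 T R R-refl ≡.refl
  , ∈⇒≥ˢφG 𝔸 T R R-refl ≡.refl
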